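{- For every set $\mathcal{B}$, the category $\mathcal{B}$-$\mathbf{Scwf}$ has an initial object.
   Context: A simply typed cwf (scwf) consists of a category $\mathcal{C}$ with a chosen terminal object $1$; a set $\mathrm{Ty}$; for each $A\in\mathrm{Ty}$ a presheaf $\mathrm{Tm}(-,A):\mathcal{C}^{\mathrm{op}}\to\mathrm{Set}$ (action written $a[\gamma]$); and for each $\Gamma\in\mathcal{C}_0$, $A\in\mathrm{Ty}$ a chosen object $\Gamma\cdot A$, morphism $\mathrm{p}_{\Gamma,A}:\Gamma\cdot A\to\Gamma$ and term $\mathrm{q}_{\Gamma,A}\in\mathrm{Tm}(\Gamma\cdot A,A)$ such that for all $\gamma:\Delta\to\Gamma$ and $a\in\mathrm{Tm}(\Delta,A)$ there is a unique $\langle\gamma,a\rangle:\Delta\to\Gamma\cdot A$ with $\mathrm{p}_{\Gamma,A}\circ\langle\gamma,a\rangle=\gamma$ and $\mathrm{q}_{\Gamma,A}[\langle\gamma,a\rangle]=a$. A strict scwf-morphism is a functor $F$ preserving $1$ on the nose, a function $F:\mathrm{Ty}\to\mathrm{Ty}'$ and natural transformations $\mathrm{Tm}(-,A)\Rightarrow\mathrm{Tm}'(F-,FA)$ with $F(\Gamma\cdot A)=F\Gamma\cdot FA$, $F(\mathrm{p}_{\Gamma,A})=\mathrm{p}_{F\Gamma,FA}$, $F(\mathrm{q}_{\Gamma,A})=\mathrm{q}_{F\Gamma,FA}$. For a set $\mathcal{B}$ (of basic types), $\mathcal{B}$-$\mathbf{Scwf}$ is the category whose objects are small scwfs together with a function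 $[\![-]\!]:\mathcal{B}\to\mathrm{Ty}$, and whose morphisms are strict scwf-morphisms commuting with these functions. -}

module Defs where

open import Level using (Level; 0ℓ) renaming (suc to lsuc)
open import Data.Product using (Σ; _,_)
open import Relation.Binary.PropositionalEquality using (_≡_; subst; subst₂)

record Scwf : Set₁ where
  infixr 9 _∘_
  infixl 8 _[_]
  infixl 7 _·_
  field
    Ob    : Set
    Hom   : Ob → Ob → Set
    id    : ∀ {Γ} → Hom Γ Γ
    _∘_   : ∀ {Θ Δ Γ} → Hom Δ Γ → Hom Θ Δ → Hom Θ Γ
    idl   : ∀ {Δ Γ} (γ : Hom Δ Γ) → id ∘ γ ≡ γ
    idr   : ∀ {Δ Γ} (γ : Hom Δ Γ) → γ ∘ id ≡ γ
    assoc : ∀ {Ξ Θ Δ Γ} (γ : Hom Δ Γ) (δ : Hom Θ Δ) (θ : Hom Ξ Θ) →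
            (γ ∘ δ) ∘ θ ≡ γ ∘ (δ ∘ θ)
    ⋄       : Ob
    !       : ∀ Γ → Hom Γ ⋄
    !-unique : ∀ {Γ} (f : Hom Γ ⋄) → f ≡ ! Γ
    Ty    : Set
    Tm    : Ob → Ty → Set
    _[_]  : ∀ {Δ Γ A} → Tm Γ A → Hom Δ Γ → Tm Δ A
    [id]  : ∀ {Γ A} (a : Tm Γ A) → a [ id ] ≡ a
    [∘]   : ∀ {Θ Δ Γ A} (a : Tm Γ A) (γ : Hom Δ Γ) (δ : Hom Θ Δ) →
            a [ γ ∘ δ ] ≡ a [ γ ] [ δ ]
    _·_   : Ob → Ty → Ob
    p     : ∀ {Γ A} → Hom (Γ · A) Γ
    q     : ∀ {Γ A} → Tm (Γ · A) A
    ⟨_,_⟩ : ∀ {Δ Γ A} → Hom Δ Γ → Tm Δ A → Hom Δ (Γ · A)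
    p∘⟨⟩  : ∀ {Δ Γ A} (γ : Hom Δ Γ) (a : Tm Δ A) → p ∘ ⟨ γ , a ⟩ ≡ γ
    q[⟨⟩] : ∀ {Δ Γ A} (γ : Hom Δ Γ) (a : Tm Δ A) → q [ ⟨ γ , a ⟩ ] ≡ a
    ⟨⟩-unique : ∀ {Δ Γ A} (γ : Hom Δ Γ) (a : Tm Δ A) (f : Hom Δ (Γ · A)) →
                p ∘ f ≡ γ → q [ f ] ≡ a → f ≡ ⟨ γ , a ⟩

record BScwf (B : Set) : Set₁ where
  field
    scwf : Scwf
  open Scwf scwf public
  field
    ⟦_⟧ : B → Ty

record BScwfMor {B : Set} (S T : BScwf B) : Set where
  private
    module S = BScwf S
    module T = BScwf T
  field
    F₀    : S.Ob → T.Ob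
    F₁    : ∀ {Δ Γ} → S.Hom Δ Γ → T.Hom (F₀ Δ) (F₀ Γ)
    F-id  : ∀ {Γ} → F₁ (S.id {Γ}) ≡ T.id
    F-∘   : ∀ {Θ Δ Γ} (γ : S.Hom Δ Γ) (δ : S.Hom Θ Δ) →
            F₁ (γ S.∘ δ) ≡ F₁ γ T.∘ F₁ δ
    F-⋄   : F₀ S.⋄ ≡ T.⋄
    FTy   : S.Ty → T.Ty
    FTm   : ∀ {Γ A} → S.Tm Γ A → T.Tm (F₀ Γ) (FTy A)
    FTm-nat : ∀ {Δ Γ A} (a : S.Tm Γ A) (γ : S.Hom Δ Γ) →
              FTm (a S.[ γ ]) ≡ FTm a T.[ F₁ γ ]
    F-·   : ∀ Γ A → F₀ (Γ S.· A) ≡ F₀ Γ T.· FTy A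
    F-p   : ∀ Γ A → subst (λ X → T.Hom X (F₀ Γ)) (F-· Γ A) (F₁ (S.p {Γ} {A}))
                    ≡ T.p
    F-q   : ∀ Γ A → subst (λ X → T.Tm X (FTy A)) (F-· Γ A) (FTm (S.q {Γ} {A}))
                    ≡ T.q
    F-⟦⟧  : ∀ b → FTy (S.⟦ b ⟧) ≡ T.⟦ b ⟧

record _≈Mor_ {B : Set} {S T : BScwf B} (F G : BScwfMor S T) : Set where
  private
    module S = BScwf S
    module T = BScwf T
    module F = BScwfMor F
    module G = BScwfMor G
  field
    ob  : ∀ Γ → F.F₀ Γ ≡ G.F₀ Γ
    ty  : ∀ A → F.FTy A ≡ G.FTy A
    hom : ∀ {Δ Γ} (γ : S.Hom Δ Γ) →
          subst₂ T.Hom (ob Δ) (ob Γ) (F.F₁ γ) ≡ G.F₁ γ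
    tm  : ∀ {Γ A} (a : S.Tm Γ A) →
          subst₂ T.Tm (ob Γ) (ty A) (F.FTm a) ≡ G.FTm a

IsInitial : {B : Set} → BScwf B → Set₁
IsInitial {B} I = (X : BScwf B) → Σ (BScwfMor I X) λ F → (G : BScwfMor I X) → G ≈Mor F

HasInitial : (B : Set) → Set₁
HasInitial B = Σ (BScwf B) IsInitial

module Submission where

-- The initial B-scwf is the free one: since an scwf has no type formers, its
-- types are just B, its contexts are lists of basic types, its terms are de
-- Bruijn variables and its morphisms are tuples of variables. A morphism into
-- any X is then forced: ⋄ and _·_ fix the objects, q and reindexing along p
-- fix the variables, and the universal property of ⟨_,_⟩ fixes the tuples.

open import Defs
open import Data.Product using () renaming (_,_ to _,Σ_)
open import Relation.Binary.PropositionalEquality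
  using (_≡_; refl; sym; trans; cong; cong₂; subst; subst₂; module ≡-Reasoning)

module ScwfProperties (S : Scwf) where
  open Scwf S

  ⟨⟩-∘ : ∀ {Θ Δ Γ A} (γ : Hom Δ Γ) (a : Tm Δ A) (δ : Hom Θ Δ) →
         ⟨ γ , a ⟩ ∘ δ ≡ ⟨ γ ∘ δ , a [ δ ] ⟩
  ⟨⟩-∘ γ a δ = ⟨⟩-unique _ _ _
    (trans (sym (assoc p ⟨ γ , a ⟩ δ)) (cong (_∘ δ) (p∘⟨⟩ γ a)))
    (trans ([∘] q ⟨ γ , a ⟩ δ) (cong (_[ δ ]) (q[⟨⟩] γ a)))

  ⟨p,q⟩≡id : ∀ {Γ A} → ⟨ p {Γ} {A} , q ⟩ ≡ id
  ⟨p,q⟩≡id = sym (⟨⟩-unique _ _ _ (idr _) ([id] _))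

  subst₂-∘ : ∀ {Θ Θ' Δ Δ' Γ Γ'} (eΘ : Θ ≡ Θ') (eΔ : Δ ≡ Δ') (eΓ : Γ ≡ Γ')
             (γ : Hom Δ Γ) (δ : Hom Θ Δ) →
             subst₂ Hom eΘ eΓ (γ ∘ δ) ≡ subst₂ Hom eΔ eΓ γ ∘ subst₂ Hom eΘ eΔ δ
  subst₂-∘ refl refl refl γ δ = refl

  subst₂-[] : ∀ {Δ Δ' Γ Γ' A A'} (eΔ : Δ ≡ Δ') (eΓ : Γ ≡ Γ') (eA : A ≡ A')
              (a : Tm Γ A) (γ : Hom Δ Γ) →
              subst₂ Tm eΔ eA (a [ γ ]) ≡ subst₂ Tm eΓ eA a [ subst₂ Hom eΔ eΓ γ ]
  subst₂-[] refl refl refl a γ = refl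

  subst₂-p : ∀ {Δ Γ Γ' A A'} (e : Δ ≡ Γ · A) (eΓ : Γ ≡ Γ') (eA : A ≡ A')
             (γ : Hom Δ Γ) → subst (λ Ξ → Hom Ξ Γ) e γ ≡ p →
             subst₂ Hom (trans e (cong₂ _·_ eΓ eA)) eΓ γ ≡ p
  subst₂-p refl refl refl γ γ≡p = γ≡p

  subst₂-q : ∀ {Δ Γ Γ' A A'} (e : Δ ≡ Γ · A) (eΓ : Γ ≡ Γ') (eA : A ≡ A')
             (a : Tm Δ A) → subst (λ Ξ → Tm Ξ A) e a ≡ q →
             subst₂ Tm (trans e (cong₂ _·_ eΓ eA)) eA a ≡ q
  subst₂-q refl refl refl a a≡q = a≡q

module FreeScwf (B : Set) where
  infixl 7 _▹_
  data Ctx : Set where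
    ε   : Ctx
    _▹_ : Ctx → B → Ctx

  variable
    Γ Δ Θ Ξ : Ctx
    A C : B

  data Var : Ctx → B → Set where
    vz : Var (Γ ▹ A) A
    vs : Var Γ A → Var (Γ ▹ C) A

  infixl 6 _,,_
  data Ren (Δ : Ctx) : Ctx → Set where
    ε    : Ren Δ ε
    _,,_ : Ren Δ Γ → Var Δ A → Ren Δ (Γ ▹ A)

  _[_]ᵛ : Var Γ A → Ren Δ Γ → Var Δ A
  vz   [ ρ ,, y ]ᵛ = y
  vs x [ ρ ,, y ]ᵛ = x [ ρ ]ᵛ

  wk : Ren Δ Γ → Ren (Δ ▹ C) Γ
  wk ε        = ε
  wk (ρ ,, x) = wk ρ ,, vs x

  idR : Ren Γ Γ
  idR {ε}     = ε
  idR {Γ ▹ A} = wk idR ,, vz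

  _∘R_ : Ren Δ Γ → Ren Θ Δ → Ren Θ Γ
  ε        ∘R σ = ε
  (ρ ,, x) ∘R σ = (ρ ∘R σ) ,, x [ σ ]ᵛ

  pR : Ren (Γ ▹ A) Γ
  pR = wk idR

  [wk]ᵛ : (x : Var Γ A) (ρ : Ren Δ Γ) → x [ wk {C = C} ρ ]ᵛ ≡ vs (x [ ρ ]ᵛ)
  [wk]ᵛ vz     (ρ ,, _) = refl
  [wk]ᵛ (vs x) (ρ ,, _) = [wk]ᵛ x ρ

  [id]ᵛ : (x : Var Γ A) → x [ idR ]ᵛ ≡ x
  [p]ᵛ  : (x : Var Γ A) → x [ pR {A = C} ]ᵛ ≡ vs x

  [id]ᵛ vz     = refl
  [id]ᵛ (vs x) = [p]ᵛ x

  [p]ᵛ x = trans ([wk]ᵛ x idR) (cong vs ([id]ᵛ x))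

  [∘]ᵛ : (x : Var Γ A) (ρ : Ren Δ Γ) (σ : Ren Θ Δ) → x [ ρ ∘R σ ]ᵛ ≡ x [ ρ ]ᵛ [ σ ]ᵛ
  [∘]ᵛ vz     (ρ ,, y) σ = refl
  [∘]ᵛ (vs x) (ρ ,, y) σ = [∘]ᵛ x ρ σ

  wk-∘ : (ρ : Ren Δ Γ) (σ : Ren Θ Δ) (y : Var Θ C) → wk ρ ∘R (σ ,, y) ≡ ρ ∘R σ
  wk-∘ ε        σ y = refl
  wk-∘ (ρ ,, x) σ y = cong (_,, x [ σ ]ᵛ) (wk-∘ ρ σ y)

  idlR : (ρ : Ren Δ Γ) → idR ∘R ρ ≡ ρ
  idlR ε        = refl
  idlR (ρ ,, x) = cong (_,, x) (trans (wk-∘ idR ρ x) (idlR ρ))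

  idrR : (ρ : Ren Δ Γ) → ρ ∘R idR ≡ ρ
  idrR ε        = refl
  idrR (ρ ,, x) = cong₂ _,,_ (idrR ρ) ([id]ᵛ x)

  assocR : (ρ : Ren Δ Γ) (σ : Ren Θ Δ) (τ : Ren Ξ Θ) → (ρ ∘R σ) ∘R τ ≡ ρ ∘R (σ ∘R τ)
  assocR ε        σ τ = refl
  assocR (ρ ,, x) σ τ = cong₂ _,,_ (assocR ρ σ τ) (sym ([∘]ᵛ x σ τ))

  ε-unique : (ρ : Ren Γ ε) → ρ ≡ ε
  ε-unique ε = refl

  pR∘,, : (ρ : Ren Δ Γ) (x : Var Δ A) → pR ∘R (ρ ,, x) ≡ ρ
  pR∘,, ρ x = trans (wk-∘ idR ρ x) (idlR ρ)

  ,,-unique : (ρ : Ren Δ Γ) (x : Var Δ A) (σ : Ren Δ (Γ ▹ A)) →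
              pR ∘R σ ≡ ρ → vz [ σ ]ᵛ ≡ x → σ ≡ ρ ,, x
  ,,-unique ρ x (σ ,, y) pσ≡ρ y≡x = cong₂ _,,_ (trans (sym (pR∘,, σ y)) pσ≡ρ) y≡x

  freeBScwf : BScwf B
  freeBScwf = record
    { scwf = record
      { Ob = Ctx ; Hom = Ren ; id = idR ; _∘_ = _∘R_
      ; idl = idlR ; idr = idrR ; assoc = assocR
      ; ⋄ = ε ; ! = λ _ → ε ; !-unique = ε-unique
      ; Ty = B ; Tm = Var ; _[_] = _[_]ᵛ ; [id] = [id]ᵛ ; [∘] = [∘]ᵛ
      ; _·_ = _▹_ ; p = pR ; q = vz ; ⟨_,_⟩ = _,,_
      ; p∘⟨⟩ = pR∘,, ; q[⟨⟩] = λ _ _ → refl ; ⟨⟩-unique = ,,-unique }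
    ; ⟦_⟧ = λ b → b }

  module Interpretation (X : BScwf B) where
    module X = BScwf X
    open X using (Hom; Tm; _∘_; _[_]; ⟨_,_⟩; _·_; p; q)
    open ScwfProperties X.scwf

    ⟦_⟧ᶜ : Ctx → X.Ob
    ⟦ ε ⟧ᶜ     = X.⋄
    ⟦ Γ ▹ A ⟧ᶜ = ⟦ Γ ⟧ᶜ · X.⟦ A ⟧

    ⟦_⟧ᵛ : Var Γ A → Tm ⟦ Γ ⟧ᶜ X.⟦ A ⟧
    ⟦ vz ⟧ᵛ   = q
    ⟦ vs x ⟧ᵛ = ⟦ x ⟧ᵛ [ p ]

    ⟦_⟧ʳ : Ren Δ Γ → Hom ⟦ Δ ⟧ᶜ ⟦ Γ ⟧ᶜ
    ⟦ ε ⟧ʳ      = X.! _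
    ⟦ ρ ,, x ⟧ʳ = ⟨ ⟦ ρ ⟧ʳ , ⟦ x ⟧ᵛ ⟩

    ⟦[]⟧ᵛ : (x : Var Γ A) (ρ : Ren Δ Γ) → ⟦ x [ ρ ]ᵛ ⟧ᵛ ≡ ⟦ x ⟧ᵛ [ ⟦ ρ ⟧ʳ ]
    ⟦[]⟧ᵛ vz     (ρ ,, y) = sym (X.q[⟨⟩] _ _)
    ⟦[]⟧ᵛ (vs x) (ρ ,, y) = begin
      ⟦ x [ ρ ]ᵛ ⟧ᵛ                          ≡⟨ ⟦[]⟧ᵛ x ρ ⟩
      ⟦ x ⟧ᵛ [ ⟦ ρ ⟧ʳ ]                      ≡⟨ cong (⟦ x ⟧ᵛ [_]) (sym (X.p∘⟨⟩ _ _)) ⟩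
      ⟦ x ⟧ᵛ [ p ∘ ⟨ ⟦ ρ ⟧ʳ , ⟦ y ⟧ᵛ ⟩ ]      ≡⟨ X.[∘] _ _ _ ⟩
      ⟦ x ⟧ᵛ [ p ] [ ⟨ ⟦ ρ ⟧ʳ , ⟦ y ⟧ᵛ ⟩ ]    ∎
      where open ≡-Reasoning

    ⟦∘⟧ʳ : (ρ : Ren Δ Γ) (σ : Ren Θ Δ) → ⟦ ρ ∘R σ ⟧ʳ ≡ ⟦ ρ ⟧ʳ ∘ ⟦ σ ⟧ʳ
    ⟦∘⟧ʳ ε        σ = sym (X.!-unique _)
    ⟦∘⟧ʳ (ρ ,, x) σ = trans (cong₂ ⟨_,_⟩ (⟦∘⟧ʳ ρ σ) (⟦[]⟧ᵛ x σ)) (sym (⟨⟩-∘ _ _ _))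

    ⟦wk⟧ʳ : (ρ : Ren Δ Γ) → ⟦ wk {C = C} ρ ⟧ʳ ≡ ⟦ ρ ⟧ʳ ∘ p
    ⟦wk⟧ʳ ε        = sym (X.!-unique _)
    ⟦wk⟧ʳ (ρ ,, x) = trans (cong ⟨_, ⟦ x ⟧ᵛ [ p ] ⟩ (⟦wk⟧ʳ ρ)) (sym (⟨⟩-∘ _ _ _))

    ⟦id⟧ʳ : ⟦ idR {Γ} ⟧ʳ ≡ X.id
    ⟦p⟧ʳ  : ⟦ pR {Γ} {A} ⟧ʳ ≡ p

    ⟦id⟧ʳ {ε}     = sym (X.!-unique _)
    ⟦id⟧ʳ {Γ ▹ A} = trans (cong ⟨_, q ⟩ (⟦p⟧ʳ {Γ} {A})) ⟨p,q⟩≡id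

    ⟦p⟧ʳ {Γ} = begin
      ⟦ wk (idR {Γ}) ⟧ʳ     ≡⟨ ⟦wk⟧ʳ (idR {Γ}) ⟩
      ⟦ idR {Γ} ⟧ʳ ∘ p      ≡⟨ cong (_∘ p) (⟦id⟧ʳ {Γ}) ⟩
      X.id ∘ p              ≡⟨ X.idl p ⟩
      p                     ∎
      where open ≡-Reasoning

    interpretation : BScwfMor freeBScwf X
    interpretation = record
      { F₀ = ⟦_⟧ᶜ ; F₁ = ⟦_⟧ʳ ; F-id = λ {Γ} → ⟦id⟧ʳ {Γ} ; F-∘ = ⟦∘⟧ʳ ; F-⋄ = refl
      ; FTy = X.⟦_⟧ ; FTm = ⟦_⟧ᵛ ; FTm-nat = ⟦[]⟧ᵛ
      ; F-· = λ _ _ → refl ; F-p = λ Γ A → ⟦p⟧ʳ {Γ} {A}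
      ; F-q = λ _ _ → refl ; F-⟦⟧ = λ _ → refl }

    module Uniqueness (G : BScwfMor freeBScwf X) where
      module G = BScwfMor G

      ob : ∀ Γ → G.F₀ Γ ≡ ⟦ Γ ⟧ᶜ
      ob ε       = G.F-⋄
      ob (Γ ▹ A) = trans (G.F-· Γ A) (cong₂ _·_ (ob Γ) (G.F-⟦⟧ A))

      G-p : ∀ Γ A → subst₂ Hom (ob (Γ ▹ A)) (ob Γ) (G.F₁ (pR {Γ} {A})) ≡ p
      G-p Γ A = subst₂-p (G.F-· Γ A) (ob Γ) (G.F-⟦⟧ A) _ (G.F-p Γ A)

      tm : (x : Var Γ A) → subst₂ Tm (ob Γ) (G.F-⟦⟧ A) (G.FTm x) ≡ ⟦ x ⟧ᵛ
      tm {Γ ▹ A} vz = subst₂-q (G.F-· Γ A) (ob Γ) (G.F-⟦⟧ A) _ (G.F-q Γ A)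
      tm {Γ ▹ C} {A} (vs x) = begin
        G↓ (G.FTm (vs x))            ≡⟨ cong (λ y → G↓ (G.FTm y)) (sym ([p]ᵛ x)) ⟩
        G↓ (G.FTm (x [ pR ]ᵛ))       ≡⟨ cong G↓ (G.FTm-nat x pR) ⟩
        G↓ (G.FTm x [ G.F₁ pR ])     ≡⟨ subst₂-[] (ob (Γ ▹ C)) (ob Γ) (G.F-⟦⟧ A) _ _ ⟩
        subst₂ Tm (ob Γ) (G.F-⟦⟧ A) (G.FTm x) [ subst₂ Hom (ob (Γ ▹ C)) (ob Γ) (G.F₁ pR) ]
                                     ≡⟨ cong₂ _[_] (tm x) (G-p Γ C) ⟩
        ⟦ x ⟧ᵛ [ p ]                 ∎
        where
        open ≡-Reasoning
        G↓ : Tm (G.F₀ (Γ ▹ C)) (G.FTy A) → Tm ⟦ Γ ▹ C ⟧ᶜ X.⟦ A ⟧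
        G↓ = subst₂ Tm (ob (Γ ▹ C)) (G.F-⟦⟧ A)

      hom : (ρ : Ren Δ Γ) → subst₂ Hom (ob Δ) (ob Γ) (G.F₁ ρ) ≡ ⟦ ρ ⟧ʳ
      hom ε = X.!-unique _
      hom {Δ} {Γ ▹ A} (ρ ,, x) = X.⟨⟩-unique _ _ _ p∘h≡⟦ρ⟧ q[h]≡⟦x⟧
        where
        open ≡-Reasoning
        h : Hom ⟦ Δ ⟧ᶜ ⟦ Γ ▹ A ⟧ᶜ
        h = subst₂ Hom (ob Δ) (ob (Γ ▹ A)) (G.F₁ (ρ ,, x))

        p∘h≡⟦ρ⟧ : p ∘ h ≡ ⟦ ρ ⟧ʳ
        p∘h≡⟦ρ⟧ = begin
          p ∘ h                                                ≡⟨ cong (_∘ h) (sym (G-p Γ A)) ⟩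
          subst₂ Hom (ob (Γ ▹ A)) (ob Γ) (G.F₁ pR) ∘ h         ≡⟨ sym (subst₂-∘ (ob Δ) (ob (Γ ▹ A)) (ob Γ) _ _) ⟩
          subst₂ Hom (ob Δ) (ob Γ) (G.F₁ pR ∘ G.F₁ (ρ ,, x))   ≡⟨ cong (subst₂ Hom (ob Δ) (ob Γ)) (sym (G.F-∘ pR (ρ ,, x))) ⟩
          subst₂ Hom (ob Δ) (ob Γ) (G.F₁ (pR ∘R (ρ ,, x)))     ≡⟨ cong (λ σ → subst₂ Hom (ob Δ) (ob Γ) (G.F₁ σ)) (pR∘,, ρ x) ⟩
          subst₂ Hom (ob Δ) (ob Γ) (G.F₁ ρ)                    ≡⟨ hom ρ ⟩
          ⟦ ρ ⟧ʳ                                               ∎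

        q[h]≡⟦x⟧ : q [ h ] ≡ ⟦ x ⟧ᵛ
        q[h]≡⟦x⟧ = begin
          q [ h ]                                                 ≡⟨ cong (_[ h ]) (sym (tm (vz {Γ} {A}))) ⟩
          subst₂ Tm (ob (Γ ▹ A)) (G.F-⟦⟧ A) (G.FTm (vz {Γ})) [ h ] ≡⟨ sym (subst₂-[] (ob Δ) (ob (Γ ▹ A)) (G.F-⟦⟧ A) _ _) ⟩
          subst₂ Tm (ob Δ) (G.F-⟦⟧ A) (G.FTm vz [ G.F₁ (ρ ,, x) ]) ≡⟨ cong (subst₂ Tm (ob Δ) (G.F-⟦⟧ A)) (sym (G.FTm-nat vz (ρ ,, x))) ⟩
          subst₂ Tm (ob Δ) (G.F-⟦⟧ A) (G.FTm x)                   ≡⟨ tm x ⟩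
          ⟦ x ⟧ᵛ                                                  ∎

      G≈interpretation : G ≈Mor interpretation
      G≈interpretation = record { ob = ob ; ty = G.F-⟦⟧ ; hom = hom ; tm = tm }

proposition4 : (B : Set) → HasInitial B
proposition4 B = freeBScwf ,Σ λ X →
  interpretation X ,Σ λ G → Interpretation.Uniqueness.G≈interpretation X G
  where open FreeScwf B
        open Interpretation using (interpretation)
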